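{- For every nonempty $A\subseteq L_k$ with $|A|=a$, we have \[ t:=|N(A)|-|A|\ \ge\ a\,\frac{1}{k}\log\frac{\binom{2k-1}{k}}{a},\] where $\log$ is the natural logarithm.
   Context: $M$ is the bipartite graph with parts $L_k=\binom{[2k-1]}{k}$ and $L_{k-1}=\binom{[2k-1]}{k-1}$ (the $k$- and $(k-1)$-element subsets of $\{1,\dots,2k-1\}$), with $u\in L_k$ adjacent to $v\in L_{k-1}$ iff $v\subseteq u$. $N(A)$ is the neighborhood of $A$ in $M$ (i.e. the lower shadow of $A$). -}

module Defs where

open import Data.Nat using (ℕ; zero; suc; _+_; _*_; _∸_; _!)
open import Data.Bool using (Bool; true; false)
open import Data.Integer using (+_)
open import Data.List using (List; []; _∷_; _++_; map; filter; length)
open import Data.List.Relation.Unary.Any using (any?)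
open import Data.Vec using (_∷_; [])
open import Data.Fin.Subset using (Subset; _⊆_; ∣_∣)
open import Data.Fin.Subset.Properties using (_⊆?_)
open import Data.Product using (∃)
open import Relation.Nullary using (Dec)
open import Relation.Nullary.Decidable using (_×-dec_)
import Data.Nat as ℕ
open import Data.Rational.Unnormalised using (ℚᵘ; _/_; 0ℚᵘ; 1ℚᵘ)
import Data.Rational.Unnormalised as Q

allSubsets : (n : ℕ) → List (Subset n)
allSubsets zero    = [] ∷ []
allSubsets (suc n) = map (true ∷_) (allSubsets n) ++ map (false ∷_) (allSubsets n)

layer : (n j : ℕ) → List (Subset n)
layer n j = filter (λ v → ∣ v ∣ ℕ.≟ j) (allSubsets n)

-- Lower shadow / neighbourhood N(A) in M: the (j)-subsets v with v ⊆ u for some u ∈ A.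
shadow : {n : ℕ} (j : ℕ) → List (Subset n) → List (Subset n)
shadow {n} j A = filter (λ v → any? (λ u → v ⊆? u) A) (layer n j)

-- The rational number m/d (d > 0 intended; m/0 := 0).
_//_ : ℕ → ℕ → ℚᵘ
m // zero  = 0ℚᵘ
m // suc d = (+ m) / suc d

_^q_ : ℚᵘ → ℕ → ℚᵘ
x ^q zero  = 1ℚᵘ
x ^q suc j = x Q.* (x ^q j)

expPartial : ℚᵘ → ℕ → ℚᵘ
expPartial x zero    = 0ℚᵘ
expPartial x (suc N) = expPartial x N Q.+ ((x ^q N) Q.* (1 // (N !)))

-- "exp x ≥ r" for a rational x ≥ 0: some partial sum of the exponential series reaches r.
-- (For rational x > 0, exp x is irrational, so exp x ≥ r ⇔ exp x > r ⇔ this; for x = 0, exp 0 = 1 = expPartial 0 1.)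
ExpAtLeast : ℚᵘ → ℚᵘ → Set
ExpAtLeast x r = ∃ λ N → r Q.≤ expPartial x N

{-# OPTIONS --safe #-}
module Submission where

-- Write a = |A|, s = |N(A)|, t = s − a and k = m + 1, so the ground set has 2k − 1 points.
-- Double counting the pairs v ⊂ u with u ∈ A gives k a ≤ k s, so a ≤ s.  Lovász's form of
-- Kruskal–Katona, proved by induction on the uniformity through the links of single points,
-- gives a ≥ binom(x, k) for x = k a / s + k − 1, i.e. ∏_{i<k} (k a + i s) ≤ a k! s^k.  As a ≤ s,
-- the left-hand side is at least a^k ∏_{i<k} (k + i) = a^k k! binom(2k − 1, k); hence
-- binom(2k − 1, k) / a ≤ (1 + t/a)^k ≤ Σ_{j≤k} (k t/a)^j / j!, a partial sum of exp(k t / a).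

open import Defs
open import Data.Bool using (Bool; true; false; if_then_else_)
import Data.Bool as Bool
open import Data.Fin using (Fin; zero; suc)
import Data.Fin.Properties as Fin
open import Data.Fin.Subset using (Subset; ∣_∣)
import Data.Fin.Subset as S
open import Data.Fin.Subset.Properties using (∣p∣≤n; drop-∷-⊆; p⊆q⇒∣p∣≤∣q∣; _⊆?_)
import Data.Integer as ℤ
import Data.Integer.Properties as ℤ
open import Data.List using (List; []; _∷_; _++_; map; filter; length)
open import Data.List.Relation.Unary.All using (All)
import Data.List.Relation.Unary.All as All
open import Data.List.Relation.Unary.AllPairs using (_∷_)
open import Data.List.Relation.Unary.Any using (Any; any?)
open import Data.List.Relation.Unary.Unique.Propositional using (Unique)
open import Data.Nat
  using (ℕ; zero; suc; _+_; _*_; _∸_; _^_; _!; _≤_; _<_; z≤n; s≤s; NonZero; >-nonZero; >-nonZero⁻¹)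
import Data.Nat as ℕ
open import Data.Nat.Combinatorics using (_C_; nCk≡n!/k![n-k]!; k![n∸k]!∣n!)
open import Data.Nat.DivMod using (_/_; m/n*n≡m)
open import Data.Nat.Properties
open import Data.Nat.Tactic.RingSolver using (solve-∀)
open import Algebra.Properties.CommutativeSemigroup +-commutativeSemigroup
  using () renaming (interchange to +-interchange)
open import Algebra.Properties.CommutativeSemigroup *-commutativeSemigroup
  using () renaming (xy∙z≈xz∙y to *-right-comm; x∙yz≈y∙xz to *-left-comm; x∙yz≈yx∙z to *-assoc-comm)
open import Algebra.Properties.Semiring.Sum +-*-semiring
  using (sum; sum-syntax; sum-replicate-zero; ∑-distrib-+; *-distribˡ-sum; *-distribʳ-sum; sum-cong-≗)
open import Data.Product using (_×_; _,_; proj₁; ∃-syntax)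
open import Data.Rational.Unnormalised using (ℚᵘ; mkℚᵘ; ↥_; ↧ₙ_; 0ℚᵘ; 1ℚᵘ)
import Data.Rational.Unnormalised as ℚ
open import Data.Vec using ([]; _∷_; lookup; _[_]≔_)
import Data.Vec as Vec
open import Data.Vec.Properties
  using (lookup∘update; lookup∘update′; []≔-commutes; []≔-updates; []≔-minimal; ≡-dec)
open import Function using (_∘_)
open import Level using (0ℓ)
open import Relation.Binary.Definitions using (DecidableEquality)
open import Relation.Binary.PropositionalEquality
open import Relation.Nullary using (Dec; yes; no; does; ¬_; contradiction)
open import Relation.Nullary.Decidable using (_×-dec_; decidable-stable)
open import Relation.Unary using (Pred; Decidable; _⊆_; _≐_; _∩_)
open import Relation.Unary.Properties using (_∩?_)

private
  variable
    A : Set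
    n j : ℕ

sumₗ : (A → ℕ) → List A → ℕ
sumₗ f []       = 0
sumₗ f (x ∷ xs) = f x + sumₗ f xs

module _ {f g : A → ℕ} where

  sumₗ-cong : (∀ x → f x ≡ g x) → ∀ xs → sumₗ f xs ≡ sumₗ g xs
  sumₗ-cong f≗g []       = refl
  sumₗ-cong f≗g (x ∷ xs) = cong₂ _+_ (f≗g x) (sumₗ-cong f≗g xs)

  sumₗ-mono-≤ : (∀ x → f x ≤ g x) → ∀ xs → sumₗ f xs ≤ sumₗ g xs
  sumₗ-mono-≤ f≤g []       = z≤n
  sumₗ-mono-≤ f≤g (x ∷ xs) = +-mono-≤ (f≤g x) (sumₗ-mono-≤ f≤g xs)

  sumₗ-distrib-+ : ∀ xs → sumₗ (λ x → f x + g x) xs ≡ sumₗ f xs + sumₗ g xs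
  sumₗ-distrib-+ []       = refl
  sumₗ-distrib-+ (x ∷ xs) = begin
    f x + g x + sumₗ (λ x → f x + g x) xs  ≡⟨ cong (f x + g x +_) (sumₗ-distrib-+ xs) ⟩
    f x + g x + (sumₗ f xs + sumₗ g xs)    ≡⟨ +-interchange (f x) (g x) _ _ ⟩
    f x + sumₗ f xs + (g x + sumₗ g xs)    ∎
    where open ≡-Reasoning

sumₗ-zero : (xs : List A) → sumₗ (λ _ → 0) xs ≡ 0
sumₗ-zero []       = refl
sumₗ-zero (_ ∷ xs) = sumₗ-zero xs

sumₗ-*ˡ : ∀ c (f : A → ℕ) xs → sumₗ (λ x → c * f x) xs ≡ c * sumₗ f xs
sumₗ-*ˡ c f []       = sym (*-zeroʳ c)
sumₗ-*ˡ c f (x ∷ xs) = trans (cong (c * f x +_) (sumₗ-*ˡ c f xs)) (sym (*-distribˡ-+ c (f x) _))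

sumₗ-++ : ∀ (f : A → ℕ) xs ys → sumₗ f (xs ++ ys) ≡ sumₗ f xs + sumₗ f ys
sumₗ-++ f []       ys = refl
sumₗ-++ f (x ∷ xs) ys = trans (cong (f x +_) (sumₗ-++ f xs ys)) (sym (+-assoc (f x) _ _))

sumₗ-map : ∀ {B : Set} (f : B → ℕ) (g : A → B) xs → sumₗ f (map g xs) ≡ sumₗ (f ∘ g) xs
sumₗ-map f g []       = refl
sumₗ-map f g (x ∷ xs) = cong (f (g x) +_) (sumₗ-map f g xs)

length≡sumₗ-1 : (xs : List A) → length xs ≡ sumₗ (λ _ → 1) xs
length≡sumₗ-1 []       = refl
length≡sumₗ-1 (_ ∷ xs) = cong suc (length≡sumₗ-1 xs)

sumₗ-∑-comm : ∀ {m} (g : Fin m → A → ℕ) xs → sumₗ (λ x → ∑[ i < m ] g i x) xs ≡ ∑[ i < m ] sumₗ (g i) xs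
sumₗ-∑-comm {m = m} g []       = sym (sum-replicate-zero m)
sumₗ-∑-comm         g (x ∷ xs) = trans (cong (sum (λ i → g i x) +_) (sumₗ-∑-comm g xs))
                                       (sym (∑-distrib-+ (λ i → g i x) (λ i → sumₗ (g i) xs)))

∑-mono-≤ : {f g : Fin n → ℕ} → (∀ i → f i ≤ g i) → sum f ≤ sum g
∑-mono-≤ {zero}  f≤g = z≤n
∑-mono-≤ {suc n} f≤g = +-mono-≤ (f≤g zero) (∑-mono-≤ (f≤g ∘ suc))

<-on-positive⇒≤ : ∀ {x y} → (0 < x → x < y) → x ≤ y
<-on-positive⇒≤ {zero}  _   = z≤n
<-on-positive⇒≤ {suc x} x<y = <⇒≤ (x<y (s≤s z≤n))

∑-mono-< : {f g : Fin n → ℕ} → (∀ i → 0 < f i → f i < g i) → 0 < sum f → sum f < sum g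
∑-mono-< {suc n} {f} f<g ∑f>0 with f zero in eq
... | zero  = +-mono-≤-< z≤n (∑-mono-< (f<g ∘ suc) ∑f>0)
... | suc _ = +-mono-<-≤ (subst (_< _) eq (f<g zero (subst (0 <_) (sym eq) (s≤s z≤n))))
                         (∑-mono-≤ (λ i → <-on-positive⇒≤ (f<g (suc i))))

𝟙 : {P : Set} → Dec P → ℕ
𝟙 d = if does d then 1 else 0

𝟙-mono : {P Q : Set} (p : Dec P) (q : Dec Q) → (P → Q) → 𝟙 p ≤ 𝟙 q
𝟙-mono (yes _) (yes _) _   = ≤-refl
𝟙-mono (yes p) (no ¬q) P→Q = contradiction (P→Q p) ¬q
𝟙-mono (no _)  _       _   = z≤n

module _ {P Q : Set} where

  𝟙-cong : (p : Dec P) (q : Dec Q) → (P → Q) → (Q → P) → 𝟙 p ≡ 𝟙 q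
  𝟙-cong p q P→Q Q→P = ≤-antisym (𝟙-mono p q P→Q) (𝟙-mono q p Q→P)

  𝟙-× : (p : Dec P) (q : Dec Q) → 𝟙 (p ×-dec q) ≡ 𝟙 p * 𝟙 q
  𝟙-× (yes _) (yes _) = refl
  𝟙-× (yes _) (no _)  = refl
  𝟙-× (no _)  _       = refl

sumₗ-filter : ∀ {P : Pred A 0ℓ} (P? : Decidable P) (f : A → ℕ) xs →
              sumₗ f (filter P? xs) ≡ sumₗ (λ x → 𝟙 (P? x) * f x) xs
sumₗ-filter P? f []       = refl
sumₗ-filter P? f (x ∷ xs) with does (P? x)
... | true  = cong₂ _+_ (sym (*-identityˡ (f x))) (sumₗ-filter P? f xs)
... | false = sumₗ-filter P? f xs

Σₛ : (Subset n → ℕ) → ℕ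
Σₛ {n} f = sumₗ f (allSubsets n)

Σₛ-split : (f : Subset (suc n) → ℕ) → Σₛ f ≡ Σₛ (f ∘ (true ∷_)) + Σₛ (f ∘ (false ∷_))
Σₛ-split {n} f = trans (sumₗ-++ f (map (true ∷_) (allSubsets n)) _)
                       (cong₂ _+_ (sumₗ-map f _ (allSubsets n)) (sumₗ-map f _ (allSubsets n)))

_≟ₛ_ : DecidableEquality (Subset n)
_≟ₛ_ = ≡-dec Bool._≟_

Σₛ-𝟙-≡ : (u : Subset n) → Σₛ (λ v → 𝟙 (v ≟ₛ u)) ≡ 1
Σₛ-𝟙-≡         []          = refl
Σₛ-𝟙-≡ {suc n} (true ∷ u)  = trans (Σₛ-split {n} _) (cong₂ _+_ (Σₛ-𝟙-≡ u) (sumₗ-zero (allSubsets n)))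
Σₛ-𝟙-≡ {suc n} (false ∷ u) = trans (Σₛ-split {n} _) (cong₂ _+_ (sumₗ-zero (allSubsets n)) (Σₛ-𝟙-≡ u))

Bit : Bool → Fin n → Pred (Subset n) 0ℓ
Bit b i v = lookup v i ≡ b

Bit? : ∀ b (i : Fin n) → Decidable (Bit b i)
Bit? b i v = lookup v i Bool.≟ b

∑-𝟙-Bit-true : (v : Subset n) → ∑[ i < n ] 𝟙 (Bit? true i v) ≡ ∣ v ∣
∑-𝟙-Bit-true []          = refl
∑-𝟙-Bit-true (true ∷ v)  = cong suc (∑-𝟙-Bit-true v)
∑-𝟙-Bit-true (false ∷ v) = ∑-𝟙-Bit-true v

∑-𝟙-Bit-false : (v : Subset n) → ∑[ i < n ] 𝟙 (Bit? false i v) ≡ n ∸ ∣ v ∣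
∑-𝟙-Bit-false []          = refl
∑-𝟙-Bit-false (true ∷ v)  = ∑-𝟙-Bit-false v
∑-𝟙-Bit-false (false ∷ v) = trans (cong suc (∑-𝟙-Bit-false v)) (sym (+-∸-assoc 1 (∣p∣≤n v)))

-- w ↦ w ∪ {i} is a bijection from the subsets avoiding i onto those containing i.
Σₛ-insert : ∀ (i : Fin n) (h : Subset n → ℕ) →
            Σₛ (λ w → 𝟙 (Bit? false i w) * h (w [ i ]≔ true)) ≡ Σₛ (λ v → 𝟙 (Bit? true i v) * h v)
Σₛ-insert {suc n} zero    h = trans (Σₛ-split {n} _)
  (trans (+-comm (Σₛ {n} (λ _ → 0)) (Σₛ (λ w → 1 * h (true ∷ w)))) (sym (Σₛ-split {n} _)))
Σₛ-insert {suc n} (suc i) h = begin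
  Σₛ (λ w → 𝟙 (Bit? false (suc i) w) * h (w [ suc i ]≔ true))
    ≡⟨ Σₛ-split {n} _ ⟩
  Σₛ (λ w → 𝟙 (Bit? false i w) * h (true ∷ w [ i ]≔ true))
    + Σₛ (λ w → 𝟙 (Bit? false i w) * h (false ∷ w [ i ]≔ true))
    ≡⟨ cong₂ _+_ (Σₛ-insert i (h ∘ (true ∷_))) (Σₛ-insert i (h ∘ (false ∷_))) ⟩
  Σₛ (λ v → 𝟙 (Bit? true i v) * h (true ∷ v))
    + Σₛ (λ v → 𝟙 (Bit? true i v) * h (false ∷ v))
    ≡⟨ Σₛ-split {n} _ ⟨
  Σₛ (λ v → 𝟙 (Bit? true (suc i) v) * h v) ∎
  where open ≡-Reasoning

∣[]≔true∣ : ∀ (i : Fin n) v → Bit false i v → ∣ v [ i ]≔ true ∣ ≡ suc ∣ v ∣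
∣[]≔true∣ zero    (false ∷ v) _ = refl
∣[]≔true∣ (suc i) (true ∷ v)  e = cong suc (∣[]≔true∣ i v e)
∣[]≔true∣ (suc i) (false ∷ v) e = ∣[]≔true∣ i v e

⊆-[]≔true : ∀ (v : Subset n) i → v S.⊆ v [ i ]≔ true
⊆-[]≔true v i {x} x∈v with x Fin.≟ i
... | yes refl = []≔-updates v x
... | no x≢i   = []≔-minimal v x i x≢i x∈v

⊆∧∣∣≡⇒≡ : ∀ {v u : Subset n} → v S.⊆ u → ∣ u ∣ ≡ ∣ v ∣ → v ≡ u
⊆∧∣∣≡⇒≡ {v = []}        {[]}        _   _ = refl
⊆∧∣∣≡⇒≡ {v = true ∷ v}  {true ∷ u}  v⊆u e = cong (true ∷_) (⊆∧∣∣≡⇒≡ (drop-∷-⊆ v⊆u) (suc-injective e))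
⊆∧∣∣≡⇒≡ {v = false ∷ v} {false ∷ u} v⊆u e = cong (false ∷_) (⊆∧∣∣≡⇒≡ (drop-∷-⊆ v⊆u) e)
⊆∧∣∣≡⇒≡ {v = false ∷ v} {true ∷ u}  v⊆u e =
  contradiction (sym e) (<⇒≢ (s≤s (p⊆q⇒∣p∣≤∣q∣ (drop-∷-⊆ v⊆u))))
⊆∧∣∣≡⇒≡ {v = true ∷ v}  {false ∷ u} v⊆u e with v⊆u Vec.here
... | ()

⊆∧∣∣≡1+⇒[]≔true : ∀ {v u : Subset n} → v S.⊆ u → ∣ u ∣ ≡ suc ∣ v ∣ →
                   ∃[ i ] Bit false i v × v [ i ]≔ true ≡ u
⊆∧∣∣≡1+⇒[]≔true {v = true ∷ v}  {true ∷ u}  v⊆u e with ⊆∧∣∣≡1+⇒[]≔true (drop-∷-⊆ v⊆u) (suc-injective e)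
... | i , vᵢ≡false , v[i]≡u = suc i , vᵢ≡false , cong (true ∷_) v[i]≡u
⊆∧∣∣≡1+⇒[]≔true {v = false ∷ v} {false ∷ u} v⊆u e with ⊆∧∣∣≡1+⇒[]≔true (drop-∷-⊆ v⊆u) e
... | i , vᵢ≡false , v[i]≡u = suc i , vᵢ≡false , cong (false ∷_) v[i]≡u
⊆∧∣∣≡1+⇒[]≔true {v = false ∷ v} {true ∷ u}  v⊆u e =
  zero , refl , cong (true ∷_) (⊆∧∣∣≡⇒≡ (drop-∷-⊆ v⊆u) (suc-injective e))
⊆∧∣∣≡1+⇒[]≔true {v = true ∷ v}  {false ∷ u} v⊆u e with v⊆u Vec.here
... | ()

-- Families of subsets: links and shadows

Family : ℕ → Set₁
Family n = Pred (Subset n) 0ℓ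

count : {P : Family n} → Decidable P → ℕ
count P? = Σₛ (𝟙 ∘ P?)

module _ {P Q : Family n} (P? : Decidable P) (Q? : Decidable Q) where

  count-mono : P ⊆ Q → count P? ≤ count Q?
  count-mono P⊆Q = sumₗ-mono-≤ (λ v → 𝟙-mono (P? v) (Q? v) P⊆Q) (allSubsets n)

  count-cong : P ≐ Q → count P? ≡ count Q?
  count-cong (P⊆Q , Q⊆P) = sumₗ-cong (λ v → 𝟙-cong (P? v) (Q? v) P⊆Q Q⊆P) (allSubsets n)

Uniform : ℕ → Family n → Set
Uniform j P = ∀ {v} → P v → ∣ v ∣ ≡ j

Link : Family n → Fin n → Family n
Link P i w = Bit false i w × P (w [ i ]≔ true)

Link? : {P : Family n} → Decidable P → ∀ i → Decidable (Link P i)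
Link? P? i w = Bit? false i w ×-dec P? (w [ i ]≔ true)

Shadow : Family n → Family n
Shadow P w = ∃[ i ] Link P i w

Shadow? : {P : Family n} → Decidable P → Decidable (Shadow P)
Shadow? P? w = Fin.any? (λ i → Link? P? i w)

module _ (P : Family n) where

  Uniform-Link : Uniform (suc j) P → ∀ i → Uniform j (Link P i)
  Uniform-Link U i {w} (wᵢ≡false , p) = suc-injective (trans (sym (∣[]≔true∣ i w wᵢ≡false)) (U p))

  Uniform-Shadow : Uniform (suc j) P → Uniform j (Shadow P)
  Uniform-Shadow U (i , l) = Uniform-Link U i l

  Link⊆Bit∩Shadow : ∀ i → Link P i ⊆ Bit false i ∩ Shadow P
  Link⊆Bit∩Shadow i l = proj₁ l , i , l

  Link-swap : ∀ {i i′} → Link (Link P i) i′ ⊆ Link (Link P i′) i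
  Link-swap {i} {i′} {w} (w[i′]≡false , w[i′]ᵢ≡false , p) =
    trans (sym (lookup∘update′ i≢i′ w true)) w[i′]ᵢ≡false ,
    trans (lookup∘update′ (i≢i′ ∘ sym) w true) w[i′]≡false ,
    subst P ([]≔-commutes w i′ i (i≢i′ ∘ sym)) p
    where
    i≢i′ : i ≢ i′
    i≢i′ refl with trans (sym (lookup∘update i w true)) w[i′]ᵢ≡false
    ... | ()

  Shadow-Link : ∀ i → Shadow (Link P i) ≐ Link (Shadow P) i
  Shadow-Link i = (λ (i′ , l) → let (wᵢ≡false , l′) = Link-swap l in wᵢ≡false , i′ , l′)
                , (λ (wᵢ≡false , i′ , l′) → i′ , Link-swap (wᵢ≡false , l′))

module _ {P : Family n} (P? : Decidable P) where

  ∑-count-Bit∩ : ∀ b {c} → (∀ {v} → P v → ∑[ i < n ] 𝟙 (Bit? b i v) ≡ c) →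
                 ∑[ i < n ] count (Bit? b i ∩? P?) ≡ c * count P?
  ∑-count-Bit∩ b {c} bits = begin
    ∑[ i < n ] count (Bit? b i ∩? P?)
      ≡⟨ sum-cong-≗ (λ i → sumₗ-cong (λ v → 𝟙-× (Bit? b i v) (P? v)) (allSubsets n)) ⟩
    ∑[ i < n ] Σₛ (λ v → 𝟙 (Bit? b i v) * 𝟙 (P? v))
      ≡⟨ sumₗ-∑-comm (λ i v → 𝟙 (Bit? b i v) * 𝟙 (P? v)) (allSubsets n) ⟨
    Σₛ (λ v → ∑[ i < n ] (𝟙 (Bit? b i v) * 𝟙 (P? v)))
      ≡⟨ sumₗ-cong (λ v → trans (sym (*-distribʳ-sum (𝟙 (P? v)) (λ i → 𝟙 (Bit? b i v))))
                                (weight v (P? v))) (allSubsets n) ⟩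
    Σₛ (λ v → c * 𝟙 (P? v))
      ≡⟨ sumₗ-*ˡ c _ (allSubsets n) ⟩
    c * count P? ∎
    where
    open ≡-Reasoning
    weight : ∀ v (p : Dec (P v)) → (∑[ i < n ] 𝟙 (Bit? b i v)) * 𝟙 p ≡ c * 𝟙 p
    weight v (yes p) = cong (_* 1) (bits p)
    weight v (no _)  = trans (*-zeroʳ (∑[ i < n ] 𝟙 (Bit? b i v))) (sym (*-zeroʳ c))

  count-Bit-split : ∀ i → count (Bit? false i ∩? P?) + count (Bit? true i ∩? P?) ≡ count P?
  count-Bit-split i = trans (sym (sumₗ-distrib-+ (allSubsets n))) (sumₗ-cong split (allSubsets n))
    where
    split : ∀ v → 𝟙 ((Bit? false i ∩? P?) v) + 𝟙 ((Bit? true i ∩? P?) v) ≡ 𝟙 (P? v)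
    split v with lookup v i
    ... | true  = refl
    ... | false = +-identityʳ _

  count-Link : ∀ i → count (Link? P? i) ≡ count (Bit? true i ∩? P?)
  count-Link i = begin
    count (Link? P? i)
      ≡⟨ sumₗ-cong (λ w → 𝟙-× (Bit? false i w) (P? (w [ i ]≔ true))) (allSubsets n) ⟩
    Σₛ (λ w → 𝟙 (Bit? false i w) * 𝟙 (P? (w [ i ]≔ true)))
      ≡⟨ Σₛ-insert i (𝟙 ∘ P?) ⟩
    Σₛ (λ v → 𝟙 (Bit? true i v) * 𝟙 (P? v))
      ≡⟨ sumₗ-cong (λ v → 𝟙-× (Bit? true i v) (P? v)) (allSubsets n) ⟨
    count (Bit? true i ∩? P?) ∎
    where open ≡-Reasoning

  ∑-count-Link : Uniform j P → ∑[ i < n ] count (Link? P? i) ≡ j * count P?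
  ∑-count-Link U = trans (sum-cong-≗ count-Link)
                         (∑-count-Bit∩ true (λ {v} p → trans (∑-𝟙-Bit-true v) (U p)))

  ∑-count-Bit-false∩ : Uniform j P → ∑[ i < n ] count (Bit? false i ∩? P?) ≡ (n ∸ j) * count P?
  ∑-count-Bit-false∩ U = ∑-count-Bit∩ false (λ {v} p → trans (∑-𝟙-Bit-false v) (cong (n ∸_) (U p)))

module _ {P : Family n} (P? : Decidable P) where

  ∑-count-Shadow-Link : Uniform (suc j) P → ∑[ i < n ] count (Shadow? (Link? P? i)) ≡ j * count (Shadow? P?)
  ∑-count-Shadow-Link U =
    trans (sum-cong-≗ (λ i → count-cong (Shadow? (Link? P? i)) (Link? (Shadow? P?) i) (Shadow-Link P i)))
          (∑-count-Link (Shadow? P?) (Uniform-Shadow P U))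

  count-Link+count-Shadow-Link≤count-Shadow : ∀ i →
    count (Link? P? i) + count (Shadow? (Link? P? i)) ≤ count (Shadow? P?)
  count-Link+count-Shadow-Link≤count-Shadow i = begin
    count (Link? P? i) + count (Shadow? (Link? P? i))
      ≤⟨ +-monoˡ-≤ _ (count-mono (Link? P? i) (Bit? false i ∩? Shadow? P?) (Link⊆Bit∩Shadow P i)) ⟩
    count (Bit? false i ∩? Shadow? P?) + count (Shadow? (Link? P? i))
      ≡⟨ cong (count (Bit? false i ∩? Shadow? P?) +_)
              (trans (count-cong (Shadow? (Link? P? i)) (Link? (Shadow? P?) i) (Shadow-Link P i))
                     (count-Link (Shadow? P?) i)) ⟩
    count (Bit? false i ∩? Shadow? P?) + count (Bit? true i ∩? Shadow? P?)
      ≡⟨ count-Bit-split (Shadow? P?) i ⟩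
    count (Shadow? P?) ∎
    where open ≤-Reasoning

  localLYM : Uniform (suc j) P → suc j * count P? ≤ (n ∸ j) * count (Shadow? P?)
  localLYM {j} U = begin
    suc j * count P?
      ≡⟨ ∑-count-Link P? U ⟨
    ∑[ i < n ] count (Link? P? i)
      ≤⟨ ∑-mono-≤ (λ i → count-mono (Link? P? i) (Bit? false i ∩? Shadow? P?) (Link⊆Bit∩Shadow P i)) ⟩
    ∑[ i < n ] count (Bit? false i ∩? Shadow? P?)
      ≡⟨ ∑-count-Bit-false∩ (Shadow? P?) (Uniform-Shadow P U) ⟩
    (n ∸ j) * count (Shadow? P?) ∎
    where open ≤-Reasoning

  count-Shadow>0 : Uniform (suc j) P → 0 < count P? → 0 < count (Shadow? P?)
  count-Shadow>0 {j} U a>0 with count (Shadow? P?) | localLYM U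
  ... | zero  | k*a≤0 =
    contradiction (≤-trans (*-monoʳ-≤ (suc j) a>0) (≤-trans k*a≤0 (≤-reflexive (*-zeroʳ (n ∸ j))))) λ ()
  ... | suc _ | _     = s≤s z≤n

-- A Lovász-type Kruskal–Katona bound

pochhammer : ℕ → ℕ → ℕ → ℕ
pochhammer d zero    y = 1
pochhammer d (suc n) y = y * pochhammer d n (y + d)

pochhammer-pascal : ∀ d n y →
  pochhammer d (suc n) (y + d) ≡ pochhammer d (suc n) y + suc n * d * pochhammer d n (y + d)
pochhammer-pascal d zero    y = ring y d
  where ring : ∀ y d → (y + d) * 1 ≡ y * 1 + 1 * d * 1
        ring = solve-∀
pochhammer-pascal d (suc n) y = begin
  (y + d) * pochhammer d (suc n) (y + d + d)           ≡⟨ cong ((y + d) *_) (pochhammer-pascal d n (y + d)) ⟩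
  (y + d) * ((y + d) * B + suc n * d * B)              ≡⟨ ring y d B n ⟩
  y * ((y + d) * B) + suc (suc n) * d * ((y + d) * B)  ∎
  where
  open ≡-Reasoning
  B : ℕ
  B = pochhammer d n (y + d + d)
  ring : ∀ y d B n → (y + d) * ((y + d) * B + suc n * d * B)
                     ≡ y * ((y + d) * B) + suc (suc n) * d * ((y + d) * B)
  ring = solve-∀

*-!-^-suc : ∀ a k d → a * suc k ! * d ^ suc k ≡ suc k * d * a * (k ! * d ^ k)
*-!-^-suc a k d = ring a k (k !) d (d ^ k)
  where ring : ∀ a k f d p → a * (suc k * f) * (d * p) ≡ suc k * d * a * (f * p)
        ring = solve-∀

module _ {P : Family n} (P? : Decidable P) (U : Uniform (suc (suc j)) P) (D Y : ℕ)
         (links-expand : ∀ i → 0 < suc j * D * count (Link? P? i) →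
                         suc j * D * count (Link? P? i) < Y * count (Shadow? (Link? P? i))) where

  private
    ∑-links : ∑[ i < n ] (suc j * D * count (Link? P? i)) ≡ suc j * (suc (suc j) * D * count P?)
    ∑-links = begin
      ∑[ i < n ] (suc j * D * count (Link? P? i))  ≡⟨ *-distribˡ-sum (suc j * D) (count ∘ Link? P?) ⟨
      suc j * D * ∑[ i < n ] count (Link? P? i)    ≡⟨ cong (suc j * D *_) (∑-count-Link P? U) ⟩
      suc j * D * (suc (suc j) * count P?)         ≡⟨ ring (suc j) D (suc (suc j)) (count P?) ⟩
      suc j * (suc (suc j) * D * count P?)         ∎
      where
      open ≡-Reasoning
      ring : ∀ k d l a → k * d * (l * a) ≡ k * (l * d * a)
      ring = solve-∀

    ∑-link-shadows : ∑[ i < n ] (Y * count (Shadow? (Link? P? i))) ≡ suc j * (Y * count (Shadow? P?))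
    ∑-link-shadows = begin
      ∑[ i < n ] (Y * count (Shadow? (Link? P? i)))  ≡⟨ *-distribˡ-sum Y (λ i → count (Shadow? (Link? P? i))) ⟨
      Y * ∑[ i < n ] count (Shadow? (Link? P? i))    ≡⟨ cong (Y *_) (∑-count-Shadow-Link P? U) ⟩
      Y * (suc j * count (Shadow? P?))               ≡⟨ *-left-comm Y (suc j) _ ⟩
      suc j * (Y * count (Shadow? P?))               ∎
      where open ≡-Reasoning

  links-expand⇒expand-≤ : suc (suc j) * D * count P? ≤ Y * count (Shadow? P?)
  links-expand⇒expand-≤ = *-cancelˡ-≤ (suc j) (subst₂ _≤_ ∑-links ∑-link-shadows
                            (∑-mono-≤ (λ i → <-on-positive⇒≤ (links-expand i))))

  links-expand⇒expand-< : .{{NonZero D}} → 0 < count P? → suc (suc j) * D * count P? < Y * count (Shadow? P?)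
  links-expand⇒expand-< a>0 = *-cancelˡ-< (suc j) _ _ (subst₂ _<_ ∑-links ∑-link-shadows
                                (∑-mono-< links-expand (subst (0 <_) (sym ∑-links) ∑-links>0)))
    where
    ∑-links>0 : 0 < suc j * (suc (suc j) * D * count P?)
    ∑-links>0 = m<n⇒m<o*n (suc j) (m<n⇒m<o*n (suc (suc j) * D) {{m*n≢0 (suc (suc j)) D}} a>0)

-- AtLeastBinomial D Y k a  says  a ≥ binom(x, k)  for  x = Y/D + k − 1.
AtLeastBinomial : ℕ → ℕ → ℕ → ℕ → Set
AtLeastBinomial D Y k a = pochhammer D k Y ≤ a * k ! * D ^ k

-- Lovász: if a uniform family has at least binom(x, k) members, its shadow has at least
-- binom(x, k − 1); below that threshold the shadow is larger than k D a / Y.  Both are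
-- proved together, splitting on whether some link of P is itself above the threshold.
module Lovász (D Y : ℕ) .{{_ : NonZero D}} .{{_ : NonZero Y}} where

  someLargeLink? : ∀ j {P : Family n} (P? : Decidable P) →
                   Dec (∃[ i ] AtLeastBinomial D Y (suc j) (count (Link? P? i)))
  someLargeLink? j P? = Fin.any? (λ i → pochhammer D (suc j) Y ≤? count (Link? P? i) * suc j ! * D ^ suc j)

  mutual
    shadow-lovász : ∀ j {P : Family n} (P? : Decidable P) → Uniform (suc j) P →
                    AtLeastBinomial D Y (suc j) (count P?) → AtLeastBinomial D (Y + D) j (count (Shadow? P?))
    shadow-lovász zero P? U h =
      subst (1 ≤_) (sym (trans (*-identityʳ _) (*-identityʳ _))) (count-Shadow>0 P? U a>0)
      where
      a>0 : 0 < count P?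
      a>0 = n≢0⇒n>0 λ a≡0 → <⇒≱ (m<n⇒m<n*o 1 (>-nonZero⁻¹ Y))
                                 (subst (λ a → Y * 1 ≤ a * 1 * (D * 1)) a≡0 h)
    shadow-lovász (suc j) P? U h with someLargeLink? j P?
    ... | yes (i , large) = largeLink⇒largeShadow j P? U i large
    ... | no ¬large = *-cancelˡ-≤ Y (begin
      Y * pochhammer D (suc j) (Y + D)     ≤⟨ h ⟩
      a * suc (suc j) ! * D ^ suc (suc j)  ≡⟨ *-!-^-suc a (suc j) D ⟩
      suc (suc j) * D * a * X              ≤⟨ *-monoˡ-≤ X (links-expand⇒expand-≤ P? U D Y
                                                             (smallLinks⇒linksExpand j P? U ¬large)) ⟩
      Y * s * X                            ≡⟨ *-assoc Y s X ⟩
      Y * (s * X)                          ≡⟨ cong (Y *_) (*-assoc s (suc j !) (D ^ suc j)) ⟨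
      Y * (s * suc j ! * D ^ suc j)        ∎)
      where
      open ≤-Reasoning
      a s X : ℕ
      a = count P?
      s = count (Shadow? P?)
      X = suc j ! * D ^ suc j

    shadow-expansion : ∀ j {P : Family n} (P? : Decidable P) → Uniform (suc j) P → 0 < count P? →
                       ¬ AtLeastBinomial D Y (suc j) (count P?) → suc j * D * count P? < Y * count (Shadow? P?)
    shadow-expansion zero P? U a>0 h = begin-strict
      1 * D * count P?        ≡⟨ ring D (count P?) ⟩
      count P? * 1 * (D * 1)  <⟨ ≰⇒> h ⟩
      Y * 1                   ≤⟨ *-monoʳ-≤ Y (count-Shadow>0 P? U a>0) ⟩
      Y * count (Shadow? P?)  ∎
      where
      open ≤-Reasoning
      ring : ∀ d a → 1 * d * a ≡ a * 1 * (d * 1)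
      ring = solve-∀
    shadow-expansion (suc j) P? U a>0 h with someLargeLink? j P?
    ... | yes (i , large) = *-cancelʳ-< X _ _ (begin-strict
      suc (suc j) * D * a * X              ≡⟨ *-!-^-suc a (suc j) D ⟨
      a * suc (suc j) ! * D ^ suc (suc j)  <⟨ ≰⇒> h ⟩
      Y * pochhammer D (suc j) (Y + D)     ≤⟨ *-monoʳ-≤ Y (largeLink⇒largeShadow j P? U i large) ⟩
      Y * (s * suc j ! * D ^ suc j)        ≡⟨ cong (Y *_) (*-assoc s (suc j !) (D ^ suc j)) ⟩
      Y * (s * X)                          ≡⟨ *-assoc Y s X ⟨
      Y * s * X                            ∎)
      where
      open ≤-Reasoning
      a s X : ℕ
      a = count P?
      s = count (Shadow? P?)
      X = suc j ! * D ^ suc j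
    ... | no ¬large = links-expand⇒expand-< P? U D Y (smallLinks⇒linksExpand j P? U ¬large) a>0

    largeLink⇒largeShadow : ∀ j {P : Family n} (P? : Decidable P) → Uniform (suc (suc j)) P → ∀ i →
                            AtLeastBinomial D Y (suc j) (count (Link? P? i)) →
                            AtLeastBinomial D (Y + D) (suc j) (count (Shadow? P?))
    largeLink⇒largeShadow j {P} P? U i large = begin
      pochhammer D (suc j) (Y + D)
        ≡⟨ pochhammer-pascal D j Y ⟩
      pochhammer D (suc j) Y + suc j * D * pochhammer D j (Y + D)
        ≤⟨ +-mono-≤ large (*-monoʳ-≤ (suc j * D) (shadow-lovász j (Link? P? i) (Uniform-Link P U i) large)) ⟩
      dᵢ * suc j ! * D ^ suc j + suc j * D * (sᵢ * j ! * D ^ j)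
        ≡⟨ ring dᵢ sᵢ j (j !) D (D ^ j) ⟩
      (dᵢ + sᵢ) * suc j ! * D ^ suc j
        ≤⟨ *-monoˡ-≤ (D ^ suc j) (*-monoˡ-≤ (suc j !) (count-Link+count-Shadow-Link≤count-Shadow P? i)) ⟩
      count (Shadow? P?) * suc j ! * D ^ suc j ∎
      where
      open ≤-Reasoning
      dᵢ sᵢ : ℕ
      dᵢ = count (Link? P? i)
      sᵢ = count (Shadow? (Link? P? i))
      ring : ∀ x y j f d p → x * (suc j * f) * (d * p) + suc j * d * (y * f * p)
                             ≡ (x + y) * (suc j * f) * (d * p)
      ring = solve-∀

    smallLinks⇒linksExpand : ∀ j {P : Family n} (P? : Decidable P) → Uniform (suc (suc j)) P →
                             ¬ (∃[ i ] AtLeastBinomial D Y (suc j) (count (Link? P? i))) →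
                             ∀ i → 0 < suc j * D * count (Link? P? i) →
                             suc j * D * count (Link? P? i) < Y * count (Shadow? (Link? P? i))
    smallLinks⇒linksExpand j {P} P? U ¬large i jDdᵢ>0 =
      shadow-expansion j (Link? P? i) (Uniform-Link P U i) dᵢ>0 (λ large → ¬large (i , large))
      where
      dᵢ>0 : 0 < count (Link? P? i)
      dᵢ>0 = >-nonZero⁻¹ _ {{m*n≢0⇒n≢0 (suc j * D) {{>-nonZero jDdᵢ>0}}}}

module _ {P : Family n} (P? : Decidable P) (U : Uniform (suc j) P) (a>0 : 0 < count P?) where

  private
    a s : ℕ
    a = count P?
    s = count (Shadow? P?)
    instance
      s≢0 : NonZero s
      s≢0 = >-nonZero (count-Shadow>0 P? U a>0)
      ka≢0 : NonZero (suc j * a)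
      ka≢0 = m*n≢0 (suc j) a {{_}} {{>-nonZero a>0}}

  -- With D = s and Y = k a, the strict alternative of Lovász would say k s a < k a s.
  shadow-lovász-bound : AtLeastBinomial s (suc j * a) (suc j) a
  shadow-lovász-bound = decidable-stable (_ ≤? _)
    (λ below → <-irrefl (*-right-comm (suc j) s a) (shadow-expansion j P? U a>0 below))
    where open Lovász s (suc j * a)

-- The middle layer

pochhammer-mono : ∀ n {d d′ y y′} → d ≤ d′ → y ≤ y′ → pochhammer d n y ≤ pochhammer d′ n y′
pochhammer-mono zero    _    _    = ≤-refl
pochhammer-mono (suc n) d≤d′ y≤y′ = *-mono-≤ y≤y′ (pochhammer-mono n d≤d′ (+-mono-≤ y≤y′ d≤d′))

pochhammer-scale : ∀ c d n y → pochhammer (c * d) n (c * y) ≡ c ^ n * pochhammer d n y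
pochhammer-scale c d zero    y = refl
pochhammer-scale c d (suc n) y = begin
  c * y * pochhammer (c * d) n (c * y + c * d)  ≡⟨ cong (λ z → c * y * pochhammer (c * d) n z) (*-distribˡ-+ c y d) ⟨
  c * y * pochhammer (c * d) n (c * (y + d))    ≡⟨ cong (c * y *_) (pochhammer-scale c d n (y + d)) ⟩
  c * y * (c ^ n * pochhammer d n (y + d))      ≡⟨ ring c y (c ^ n) (pochhammer d n (y + d)) ⟩
  c * c ^ n * (y * pochhammer d n (y + d))      ∎
  where
  open ≡-Reasoning
  ring : ∀ c y p q → c * y * (p * q) ≡ c * p * (y * q)
  ring = solve-∀

pochhammer-factorial : ∀ n y → y ! * pochhammer 1 n (suc y) ≡ (y + n) !
pochhammer-factorial zero    y = trans (*-identityʳ _) (cong _! (sym (+-identityʳ y)))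
pochhammer-factorial (suc n) y = begin
  y ! * (suc y * pochhammer 1 n (suc y + 1))   ≡⟨ cong (λ z → y ! * (suc y * pochhammer 1 n z)) (+-comm (suc y) 1) ⟩
  y ! * (suc y * pochhammer 1 n (suc (suc y))) ≡⟨ *-assoc-comm (y !) (suc y) _ ⟩
  suc y ! * pochhammer 1 n (suc (suc y))       ≡⟨ pochhammer-factorial n (suc y) ⟩
  (suc y + n) !                                ≡⟨ cong _! (+-suc y n) ⟨
  (y + suc n) !                                ∎
  where open ≡-Reasoning

central-binomial-pochhammer : ∀ m → (suc (m + m) C suc m) * suc m ! ≡ pochhammer 1 (suc m) (suc m)
central-binomial-pochhammer m = *-cancelʳ-≡ _ _ (m !) {{m !≢0}} (begin
  b * suc m ! * m !                                           ≡⟨ *-assoc b (suc m !) (m !) ⟩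
  b * (suc m ! * m !)                                         ≡⟨ cong (λ z → b * (suc m ! * z !)) (m+n∸m≡n m m) ⟨
  b * (suc m ! * (N ∸ suc m) !)                               ≡⟨ cong (_* (suc m ! * (N ∸ suc m) !)) (nCk≡n!/k![n-k]! k≤N) ⟩
  N ! / (suc m ! * (N ∸ suc m) !) * (suc m ! * (N ∸ suc m) !) ≡⟨ m/n*n≡m (k![n∸k]!∣n! k≤N) ⟩
  N !                                                         ≡⟨ cong _! (+-suc m m) ⟨
  (m + suc m) !                                               ≡⟨ pochhammer-factorial (suc m) m ⟨
  m ! * pochhammer 1 (suc m) (suc m)                          ≡⟨ *-comm (m !) _ ⟩
  pochhammer 1 (suc m) (suc m) * m !                          ∎)
  where
  open ≡-Reasoning
  N b : ℕ
  N = suc (m + m)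
  b = N C suc m
  k≤N : suc m ≤ N
  k≤N = s≤s (m≤m+n m m)
  instance
    k!*[N∸k]!≢0 : NonZero (suc m ! * (N ∸ suc m) !)
    k!*[N∸k]!≢0 = suc m !* (N ∸ suc m) !≢0

module _ {m} {P : Family (suc (m + m))} (P? : Decidable P) (U : Uniform (suc m) P) (a>0 : 0 < count P?) where

  private
    a s k : ℕ
    a = count P?
    s = count (Shadow? P?)
    k = suc m

  middleLayer-count≤count-Shadow : a ≤ s
  middleLayer-count≤count-Shadow = *-cancelˡ-≤ k (subst (λ c → k * a ≤ c * s) 2m+1∸m≡k (localLYM P? U))
    where
    2m+1∸m≡k : suc (m + m) ∸ m ≡ k
    2m+1∸m≡k = trans (cong (_∸ m) (sym (+-suc m m))) (m+n∸m≡n m k)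

  middleLayer-binomial-bound : (suc (m + m) C k) * a ^ k ≤ a * s ^ k
  middleLayer-binomial-bound = *-cancelʳ-≤ _ _ (k !) {{k !≢0}} (begin
    b * a ^ k * k !               ≡⟨ *-right-comm b (a ^ k) (k !) ⟩
    b * k ! * a ^ k               ≡⟨ cong (_* a ^ k) (central-binomial-pochhammer m) ⟩
    pochhammer 1 k k * a ^ k      ≡⟨ *-comm _ (a ^ k) ⟩
    a ^ k * pochhammer 1 k k      ≡⟨ pochhammer-scale a 1 k k ⟨
    pochhammer (a * 1) k (a * k)  ≤⟨ pochhammer-mono k (≤-trans (≤-reflexive (*-identityʳ a)) middleLayer-count≤count-Shadow)
                                                       (≤-reflexive (*-comm a k)) ⟩
    pochhammer s k (k * a)        ≤⟨ shadow-lovász-bound P? U a>0 ⟩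
    a * k ! * s ^ k               ≡⟨ *-right-comm a (k !) (s ^ k) ⟩
    a * s ^ k * k !               ∎)
    where
    open ≤-Reasoning
    b : ℕ
    b = suc (m + m) C k

-- Partial sums of the exponential series

-- scaledExpPartial a p N = a ^ N * N ! * Σ_{j ≤ N} (p / a) ^ j / j !
scaledExpPartial : ℕ → ℕ → ℕ → ℕ
scaledExpPartial a p zero    = 1
scaledExpPartial a p (suc N) = a * suc N * scaledExpPartial a p N + p ^ suc N

bernoulli : ∀ p t N → p ^ suc N + suc N * p ^ N * t ≤ (p + t) ^ suc N
bernoulli p t zero    = ≤-reflexive (ring p t)
  where ring : ∀ p t → p * 1 + 1 * 1 * t ≡ (p + t) * 1
        ring = solve-∀
bernoulli p t (suc N) = begin
  p * p ^ suc N + suc (suc N) * p ^ suc N * t                          ≤⟨ m≤m+n _ _ ⟩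
  p * p ^ suc N + suc (suc N) * p ^ suc N * t + suc N * p ^ N * t * t  ≡⟨ ring p (p ^ N) t N ⟨
  (p + t) * (p ^ suc N + suc N * p ^ N * t)                            ≤⟨ *-monoʳ-≤ (p + t) (bernoulli p t N) ⟩
  (p + t) * (p + t) ^ suc N                                            ∎
  where
  open ≤-Reasoning
  ring : ∀ p q t N → (p + t) * (p * q + suc N * q * t)
                     ≡ p * (p * q) + suc (suc N) * (p * q) * t + suc N * q * t * t
  ring = solve-∀

scaledExpPartial-taylor : ∀ a p t N →
  scaledExpPartial a p (suc N) + t * suc N * scaledExpPartial a p N ≤ scaledExpPartial a (p + t) (suc N)
scaledExpPartial-taylor a p t zero    = ≤-reflexive (ring a p t)
  where ring : ∀ a p t → a * 1 * 1 + p * 1 + t * 1 * 1 ≡ a * 1 * 1 + (p + t) * 1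
        ring = solve-∀
scaledExpPartial-taylor a p t (suc N) = begin
  a * suc (suc N) * x + p ^ suc (suc N) + t * suc (suc N) * (a * suc N * y + p ^ suc N)
    ≡⟨ ring a p N x y t (p ^ suc N) ⟩
  a * suc (suc N) * (x + t * suc N * y) + (p ^ suc (suc N) + suc (suc N) * p ^ suc N * t)
    ≤⟨ +-mono-≤ (*-monoʳ-≤ (a * suc (suc N)) (scaledExpPartial-taylor a p t N)) (bernoulli p t (suc N)) ⟩
  a * suc (suc N) * scaledExpPartial a (p + t) (suc N) + (p + t) ^ suc (suc N) ∎
  where
  open ≤-Reasoning
  x y : ℕ
  x = scaledExpPartial a p (suc N)
  y = scaledExpPartial a p N
  ring : ∀ a p N x y t q → a * suc (suc N) * x + p * q + t * suc (suc N) * (a * suc N * y + q)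
                           ≡ a * suc (suc N) * (x + t * suc N * y) + (p * q + suc (suc N) * q * t)
  ring = solve-∀

scaledExpPartial-step : ∀ a p t N → suc N * (a + t) * scaledExpPartial a p N ≤ scaledExpPartial a (p + t) (suc N)
scaledExpPartial-step a p t N = begin
  suc N * (a + t) * x                     ≡⟨ ring a t N x ⟩
  a * suc N * x + t * suc N * x           ≤⟨ +-monoˡ-≤ (t * suc N * x) (m≤m+n (a * suc N * x) (p ^ suc N)) ⟩
  scaledExpPartial a p (suc N) + t * suc N * x  ≤⟨ scaledExpPartial-taylor a p t N ⟩
  scaledExpPartial a (p + t) (suc N)      ∎
  where
  open ≤-Reasoning
  x : ℕ
  x = scaledExpPartial a p N
  ring : ∀ a t N x → suc N * (a + t) * x ≡ a * suc N * x + t * suc N * x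
  ring = solve-∀

pow≤scaledExpPartial : ∀ a t N → N ! * (a + t) ^ N ≤ scaledExpPartial a (N * t) N
pow≤scaledExpPartial a t zero    = ≤-refl
pow≤scaledExpPartial a t (suc N) = begin
  suc N ! * (a + t) ^ suc N                      ≡⟨ ring N (N !) (a + t) ((a + t) ^ N) ⟩
  suc N * (a + t) * (N ! * (a + t) ^ N)          ≤⟨ *-monoʳ-≤ (suc N * (a + t)) (pow≤scaledExpPartial a t N) ⟩
  suc N * (a + t) * scaledExpPartial a (N * t) N ≤⟨ scaledExpPartial-step a (N * t) t N ⟩
  scaledExpPartial a (N * t + t) (suc N)         ≡⟨ cong (λ p → scaledExpPartial a p (suc N)) (+-comm (N * t) t) ⟩
  scaledExpPartial a (suc N * t) (suc N)         ∎
  where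
  open ≤-Reasoning
  ring : ∀ N f s q → suc N * f * (s * q) ≡ suc N * s * (f * q)
  ring = solve-∀

-- ℚᵘ does not normalise, so the numerator and denominator of a term built from _//_, ℚ._+_
-- and ℚ._*_ are exactly those given by the cross-multiplication formulas.
record NumDen (q : ℚᵘ) (m d : ℕ) : Set where
  constructor numDen
  field
    numerator   : ↥ q ≡ ℤ.+ m
    denominator : ↧ₙ q ≡ d

numDen-// : ∀ m d .{{_ : NonZero d}} → NumDen (m // d) m d
numDen-// m (suc d) = numDen refl refl

numDen-+ : ∀ {q r m d m′ d′} → NumDen q m d → NumDen r m′ d′ → NumDen (q ℚ.+ r) (m * d′ + m′ * d) (d * d′)
numDen-+ {mkℚᵘ _ _} {mkℚᵘ _ _} {m} {_} {m′} (numDen refl refl) (numDen refl refl) =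
  numDen (trans (cong₂ ℤ._+_ (sym (ℤ.pos-* m _)) (sym (ℤ.pos-* m′ _))) (sym (ℤ.pos-+ (m * _) (m′ * _)))) refl

numDen-* : ∀ {q r m d m′ d′} → NumDen q m d → NumDen r m′ d′ → NumDen (q ℚ.* r) (m * m′) (d * d′)
numDen-* {mkℚᵘ _ _} {mkℚᵘ _ _} {m} {_} {m′} (numDen refl refl) (numDen refl refl) = numDen (sym (ℤ.pos-* m m′)) refl

numDen-^q : ∀ {q m d} → NumDen q m d → ∀ N → NumDen (q ^q N) (m ^ N) (d ^ N)
numDen-^q q≈m/d zero    = numDen refl refl
numDen-^q q≈m/d (suc N) = numDen-* q≈m/d (numDen-^q q≈m/d N)

numDen-≤ : ∀ {q r m d m′ d′} → NumDen q m d → NumDen r m′ d′ → m * d′ ≤ m′ * d → q ℚ.≤ r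
numDen-≤ {mkℚᵘ _ _} {mkℚᵘ _ _} {m} {_} {m′} (numDen refl refl) (numDen refl refl) m*d′≤m′*d =
  ℚ.*≤* (subst₂ ℤ._≤_ (ℤ.pos-* m _) (ℤ.pos-* m′ _) (ℤ.+≤+ m*d′≤m′*d))

module _ (a p : ℕ) .{{_ : NonZero a}} where

  expPartial-numDen : ∀ N → ∃[ m ] ∃[ d ] NumDen (expPartial (p // a) (suc N)) m d
                                         × m * (a ^ N * N !) ≡ scaledExpPartial a p N * d
  expPartial-numDen zero    =
    _ , _ , numDen-+ {0ℚᵘ} (numDen refl refl) (numDen-* {1ℚᵘ} (numDen refl refl) (numDen-// 1 1)) , refl
  expPartial-numDen (suc N) with expPartial-numDen N
  ... | m , d , m/d , m*W≡e*d =
    _ , _ , numDen-+ m/d (numDen-* (numDen-^q (numDen-// p a) (suc N)) (numDen-// 1 (suc N !) {{suc N !≢0}})) ,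
    (begin
      (m * W′ + p ^ suc N * 1 * d) * W′
        ≡⟨ cong (λ z → (z + p ^ suc N * 1 * d) * W′) m*W′≡ ⟩
      (a * suc N * (scaledExpPartial a p N * d) + p ^ suc N * 1 * d) * W′
        ≡⟨ ring a N (scaledExpPartial a p N) d (p ^ suc N) W′ ⟩
      scaledExpPartial a p (suc N) * (d * W′) ∎)
    where
    open ≡-Reasoning
    W′ : ℕ
    W′ = a ^ suc N * suc N !
    m*W′≡ : m * W′ ≡ a * suc N * (scaledExpPartial a p N * d)
    m*W′≡ = trans (ring′ m a (a ^ N) N (N !)) (cong (a * suc N *_) m*W≡e*d)
      where ring′ : ∀ m a q N f → m * (a * q * (suc N * f)) ≡ a * suc N * (m * (q * f))
            ring′ = solve-∀
    ring : ∀ a N e d q w → (a * suc N * (e * d) + q * 1 * d) * w ≡ (a * suc N * e + q) * (d * w)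
    ring = solve-∀

power-bound⇒expAtLeast : ∀ {a s c} k .{{_ : NonZero a}} → a ≤ s → c * a ^ k ≤ a * s ^ k →
                         ExpAtLeast ((k * (s ∸ a)) // a) (c // a)
power-bound⇒expAtLeast {a} {s} {c} k a≤s c*aᵏ≤a*sᵏ with expPartial-numDen a (k * (s ∸ a)) k
... | m , d , m/d , m*W≡e*d =
  suc k , numDen-≤ (numDen-// c a) m/d (*-cancelʳ-≤ (c * d) (m * a) W {{W≢0}} (begin
  c * d * W                                    ≡⟨ ring₁ c d (a ^ k) (k !) ⟩
  c * a ^ k * k ! * d                          ≤⟨ *-monoˡ-≤ d (*-monoˡ-≤ (k !) c*aᵏ≤a*sᵏ) ⟩
  a * s ^ k * k ! * d                          ≡⟨ ring₂ a (s ^ k) (k !) d ⟩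
  a * (k ! * s ^ k) * d                        ≡⟨ cong (λ x → a * (k ! * x ^ k) * d) (m+[n∸m]≡n a≤s) ⟨
  a * (k ! * (a + (s ∸ a)) ^ k) * d            ≤⟨ *-monoˡ-≤ d (*-monoʳ-≤ a (pow≤scaledExpPartial a (s ∸ a) k)) ⟩
  a * scaledExpPartial a (k * (s ∸ a)) k * d   ≡⟨ *-assoc a _ d ⟩
  a * (scaledExpPartial a (k * (s ∸ a)) k * d) ≡⟨ cong (a *_) m*W≡e*d ⟨
  a * (m * W)                                  ≡⟨ ring₃ a m W ⟩
  m * a * W                                    ∎))
  where
  open ≤-Reasoning
  W : ℕ
  W = a ^ k * k !
  W≢0 : NonZero W
  W≢0 = m*n≢0 (a ^ k) (k !) {{m^n≢0 a k}} {{k !≢0}}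
  ring₁ : ∀ c d p f → c * d * (p * f) ≡ c * p * f * d
  ring₁ = solve-∀
  ring₂ : ∀ a p f d → a * p * f * d ≡ a * (f * p) * d
  ring₂ = solve-∀
  ring₃ : ∀ a m w → a * (m * w) ≡ m * a * w
  ring₃ = solve-∀

≢[]⇒length>0 : {xs : List A} → xs ≢ [] → 0 < length xs
≢[]⇒length>0 {xs = []}    []≢[] = contradiction refl []≢[]
≢[]⇒length>0 {xs = _ ∷ _} _     = s≤s z≤n

module _ {n : ℕ} where
  open import Data.List.Membership.DecPropositional (_≟ₛ_ {n}) using (_∈_; _∈?_; find; lose)

  count-∈ : (A : List (Subset n)) → Unique A → count (_∈? A) ≡ length A
  count-∈ []      _               = sumₗ-zero (allSubsets n)
  count-∈ (u ∷ A) (u∉A ∷ unique) = begin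
    count (_∈? (u ∷ A))                    ≡⟨ sumₗ-cong 𝟙-∈-∷ (allSubsets n) ⟩
    Σₛ (λ v → 𝟙 (v ≟ₛ u) + 𝟙 (v ∈? A))    ≡⟨ sumₗ-distrib-+ (allSubsets n) ⟩
    Σₛ (λ v → 𝟙 (v ≟ₛ u)) + count (_∈? A)  ≡⟨ cong₂ _+_ (Σₛ-𝟙-≡ u) (count-∈ A unique) ⟩
    suc (length A)                         ∎
    where
    open ≡-Reasoning
    𝟙-∈-∷ : ∀ v → 𝟙 (v ∈? (u ∷ A)) ≡ 𝟙 (v ≟ₛ u) + 𝟙 (v ∈? A)
    𝟙-∈-∷ v with v ≟ₛ u | v ∈? A
    ... | yes refl | yes v∈A = contradiction refl (All.lookup u∉A v∈A)
    ... | yes _    | no _    = refl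
    ... | no _     | yes _   = refl
    ... | no _     | no _    = refl

  module _ (A : List (Subset n)) (m : ℕ) (U : Uniform (suc m) (_∈ A)) where

    layer∩below≐Shadow : (λ v → ∣ v ∣ ≡ m × Any (v S.⊆_) A) ≐ Shadow (_∈ A)
    layer∩below≐Shadow = to , from
      where
      to : ∀ {v} → ∣ v ∣ ≡ m × Any (v S.⊆_) A → Shadow (_∈ A) v
      to {v} (∣v∣≡m , below) with find below
      ... | u , u∈A , v⊆u with ⊆∧∣∣≡1+⇒[]≔true v⊆u (trans (U u∈A) (cong suc (sym ∣v∣≡m)))
      ... | i , vᵢ≡false , v[i]≡u = i , vᵢ≡false , subst (_∈ A) (sym v[i]≡u) u∈A
      from : ∀ {v} → Shadow (_∈ A) v → ∣ v ∣ ≡ m × Any (v S.⊆_) A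
      from {v} (i , l@(_ , v[i]∈A)) = Uniform-Shadow (_∈ A) U (i , l) , lose v[i]∈A (⊆-[]≔true v i)

    length-shadow : length (shadow m A) ≡ count (Shadow? (_∈? A))
    length-shadow = begin
      length (shadow m A)
        ≡⟨ length≡sumₗ-1 (shadow m A) ⟩
      sumₗ (λ _ → 1) (filter Below? (filter Layer? (allSubsets n)))
        ≡⟨ sumₗ-filter Below? (λ _ → 1) (filter Layer? (allSubsets n)) ⟩
      sumₗ (λ v → 𝟙 (Below? v) * 1) (filter Layer? (allSubsets n))
        ≡⟨ sumₗ-filter Layer? _ (allSubsets n) ⟩
      Σₛ (λ v → 𝟙 (Layer? v) * (𝟙 (Below? v) * 1))
        ≡⟨ sumₗ-cong 𝟙-layer∩below (allSubsets n) ⟩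
      count (Layer? ∩? Below?)
        ≡⟨ count-cong (Layer? ∩? Below?) (Shadow? (_∈? A)) layer∩below≐Shadow ⟩
      count (Shadow? (_∈? A)) ∎
      where
      open ≡-Reasoning
      Layer? : Decidable (λ v → ∣ v ∣ ≡ m)
      Layer? v = ∣ v ∣ ℕ.≟ m
      Below? : Decidable (λ v → Any (v S.⊆_) A)
      Below? v = any? (λ u → v ⊆? u) A
      𝟙-layer∩below : ∀ v → 𝟙 (Layer? v) * (𝟙 (Below? v) * 1) ≡ 𝟙 ((Layer? ∩? Below?) v)
      𝟙-layer∩below v = trans (cong (𝟙 (Layer? v) *_) (*-identityʳ _)) (sym (𝟙-× (Layer? v) (Below? v)))

lemma1p6 : (m : ℕ) (A : List (Subset (suc (m + m))))
           → Unique A → All (λ u → ∣ u ∣ ≡ suc m) A → A ≢ []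
           → length A ≤ length (shadow m A)
             × ExpAtLeast ((suc m * (length (shadow m A) ∸ length A)) // length A)
                          ((suc (m + m) C suc m) // length A)
lemma1p6 m A unique uniform A≢[] = a≤s , power-bound⇒expAtLeast (suc m) a≤s power-bound
  where
  open import Data.List.Membership.DecPropositional (_≟ₛ_ {suc (m + m)}) using (_∈_; _∈?_)
  U : Uniform (suc m) (_∈ A)
  U = All.lookup uniform
  a≡ : count (_∈? A) ≡ length A
  a≡ = count-∈ A unique
  s≡ : count (Shadow? (_∈? A)) ≡ length (shadow m A)
  s≡ = sym (length-shadow A m U)
  a>0 : 0 < count (_∈? A)
  a>0 = subst (0 <_) (sym a≡) (≢[]⇒length>0 A≢[])
  instance
    a≢0 : NonZero (length A)
    a≢0 = >-nonZero (≢[]⇒length>0 A≢[])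
  a≤s : length A ≤ length (shadow m A)
  a≤s = subst₂ _≤_ a≡ s≡ (middleLayer-count≤count-Shadow (_∈? A) U a>0)
  power-bound : (suc (m + m) C suc m) * length A ^ suc m ≤ length A * length (shadow m A) ^ suc m
  power-bound = subst₂ (λ a s → (suc (m + m) C suc m) * a ^ suc m ≤ a * s ^ suc m) a≡ s≡
                       (middleLayer-binomial-bound (_∈? A) U a>0)
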